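{- For every $n\ge1$ and $\pi\in\mathfrak{S}_n$, \[\mathcal{D}^{(\ell)}(\pi)=\sum_{\substack{E\subseteq\{0,\dots,n-1\}\\ \mathrm{lPe}(\pi)\subseteq E\cup(E+1)}}2^{|E|}N_E.\]
   Context: $\mathfrak{S}_n$ is the symmetric group on $[n]$; $\mathrm{Des}(\pi)=\{i\in[n-1]:\pi(i)>\pi(i+1)\}$. With $\pi(0)=\pi(n+1)=0$, $\mathrm{lPe}(\pi)$ is the set of $i$ with $1\le i<n$ and $\pi(i-1)<\pi(i)>\pi(i+1)$. For a set $E$ of integers, $E+1=\{e+1:e\in E\}$. Let $\mathbb{P}^{(\ell)}=\{0,-1,1,-2,2,\dots\}$ with total order $0<-1<1<-2<2<\cdots$; $a\le^+b$ means $a<b$ or $a=b\ge0$, $a\le^-b$ means $a<b$ or $a=b<0$. With commuting indeterminates $z_0,z_1,\dots$, $\mathcal{D}^{(\ell)}(\pi)=\sum\prod_{s=1}^n z_{|a_s|}$ over all $(a_1,\dots,a_n)\in(\mathbb{P}^{(\ell)})^n$ with $a_s\le^+a_{s+1}$ for $s\in[n-1]\setminus\mathrm{Des}(\pi)$ and $a_s\le^-a_{s+1}$ for $s\in\mathrm{Des}(\pi)$. For $S=\{s_1<\dots<s_m\}\subseteq\{0,\dots,n-1\}$ (with $s_{m+1}:=n$), $N_S=\sum_{0<i_1<\dots<i_m}z_0^{s_1}\prod_{r=1}^m z_{i_r}^{s_{r+1}-s_r}$ (so $N_\emptyset=z_0^n$). -}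

module Defs where

open import Data.Bool using (Bool; true; false; _∧_; _∨_; not; if_then_else_)
open import Data.Nat using (ℕ; zero; suc; _+_; _*_; _∸_; _^_; _<ᵇ_; _≡ᵇ_; _≤ᵇ_)
open import Data.Integer using (ℤ; +_; -[1+_]; ∣_∣)
open import Data.List using (List; []; _∷_; _++_; map; concatMap; length; upTo; replicate)
open import Data.Fin using (Fin; toℕ)
open import Data.Fin.Permutation using (Permutation′; _⟨$⟩ʳ_)
open import Data.Vec using (Vec; lookup; allFin)
import Data.Vec as Vec

-- 1-based access into a list, with default d at position 0 and beyond the end
nth : {A : Set} → A → List A → ℕ → A
nth d xs zero = d
nth d [] (suc k) = d
nth d (x ∷ xs) (suc zero) = x
nth d (x ∷ xs) (suc (suc k)) = nth d xs (suc k)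

allᵇ : {A : Set} → (A → Bool) → List A → Bool
allᵇ p [] = true
allᵇ p (x ∷ xs) = p x ∧ allᵇ p xs

sumℕ : List ℕ → ℕ
sumℕ [] = 0
sumℕ (x ∷ xs) = x + sumℕ xs

countᵇ : {A : Set} → (A → Bool) → List A → ℕ
countᵇ p [] = 0
countᵇ p (x ∷ xs) = (if p x then 1 else 0) + countᵇ p xs

filterᵇ : {A : Set} → (A → Bool) → List A → List A
filterᵇ p [] = []
filterᵇ p (x ∷ xs) = if p x then x ∷ filterᵇ p xs else filterᵇ p xs

tuples : {A : Set} → ℕ → List A → List (List A)
tuples zero xs = [] ∷ []
tuples (suc k) xs = concatMap (λ x → map (x ∷_) (tuples k xs)) xs

choose : ℕ → List ℕ → List (List ℕ)
choose zero xs = [] ∷ []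
choose (suc m) [] = []
choose (suc m) (x ∷ xs) = map (x ∷_) (choose m xs) ++ choose (suc m) xs

oneTo : ℕ → List ℕ
oneTo k = map suc (upTo k)

-- Permutations: values π(1),...,π(n) in 1..n, with π(0)=π(n+1)=0

values : {n : ℕ} → Permutation′ n → List ℕ
values {n} π = Vec.toList (Vec.map (λ i → suc (toℕ (π ⟨$⟩ʳ i))) (allFin n))

pv : {n : ℕ} → Permutation′ n → ℕ → ℕ
pv π i = nth 0 (values π) i

isDes : (n : ℕ) → Permutation′ n → ℕ → Bool
isDes n π i = (1 ≤ᵇ i) ∧ ((i <ᵇ n) ∧ (pv π (suc i) <ᵇ pv π i))

isLPe : (n : ℕ) → Permutation′ n → ℕ → Bool
isLPe n π i = (1 ≤ᵇ i) ∧ ((i <ᵇ n) ∧ ((pv π (i ∸ 1) <ᵇ pv π i) ∧ (pv π (suc i) <ᵇ pv π i)))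

-- The ordered alphabet P^(ℓ) = ℤ with 0 < -1 < 1 < -2 < 2 < ...

key : ℤ → ℕ
key (+ zero) = 0
key (+ (suc k)) = 2 * k + 2
key -[1+ k ] = 2 * k + 1

nonneg : ℤ → Bool
nonneg (+ _) = true
nonneg -[1+ _ ] = false

ltℓ : ℤ → ℤ → Bool
ltℓ a b = key a <ᵇ key b

leq⁺ : ℤ → ℤ → Bool
leq⁺ a b = ltℓ a b ∨ ((key a ≡ᵇ key b) ∧ nonneg a)

leq⁻ : ℤ → ℤ → Bool
leq⁻ a b = ltℓ a b ∨ ((key a ≡ᵇ key b) ∧ not (nonneg a))

PℓUpTo : ℕ → List ℤ
PℓUpTo K = + 0 ∷ concatMap (λ k → -[1+ k ] ∷ + (suc k) ∷ []) (upTo K)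

-- Monomials.  A monomial is given by a list of factor indices
-- [j₁,…,j_n] standing for z_{j₁}⋯z_{j_n}.  The target monomial
-- ∏_{j ≤ K} z_j^{e_j} is given by e : Vec ℕ (suc K).

occ : ℕ → List ℕ → ℕ
occ j m = countᵇ (λ x → x ≡ᵇ j) m

matches : (K : ℕ) → Vec ℕ (suc K) → List ℕ → Bool
matches K e m = allᵇ (λ x → x ≤ᵇ K) m
  ∧ Vec.foldr (λ _ → Bool) _∧_ true
      (Vec.map (λ j → occ (toℕ j) m ≡ᵇ lookup e j) (allFin (suc K)))

-- Coefficient of ∏_{j≤K} z_j^{e_j} in D^(ℓ)(π).
-- Only words with all |a_s| ≤ K can contribute to this monomial.

validD : (n : ℕ) → Permutation′ n → List ℤ → Bool
validD n π a = allᵇ (λ s → if isDes n π s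
                            then leq⁻ (nth (+ 0) a s) (nth (+ 0) a (suc s))
                            else leq⁺ (nth (+ 0) a s) (nth (+ 0) a (suc s)))
                   (oneTo (n ∸ 1))

coeffD : (n : ℕ) → Permutation′ n → (K : ℕ) → Vec ℕ (suc K) → ℕ
coeffD n π K e =
  countᵇ (λ a → validD n π a ∧ matches K e (map ∣_∣ a)) (tuples n (PℓUpTo K))

-- Subsets E ⊆ {0,…,n-1} as bit lists (bit k ↔ k ∈ E)

memb : List Bool → ℕ → Bool
memb E k = nth false E (suc k)

elems : (n : ℕ) → List Bool → List ℕ
elems n E = filterᵇ (memb E) (upTo n)

admissible : (n : ℕ) → Permutation′ n → List Bool → Bool
admissible n π E = allᵇ (λ i → if isLPe n π i then memb E i ∨ ((1 ≤ᵇ i) ∧ memb E (i ∸ 1)) else true)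
                       (upTo n)

-- factor list of z_0^{s₁} ∏_r z_{i_r}^{s_{r+1}-s_r}, with s_{m+1} = n
nextS : List ℕ → ℕ → ℕ
nextS [] n = n
nextS (x ∷ _) n = x

blocks : ℕ → List ℕ → List ℕ → List ℕ
blocks n (s ∷ ss) (i ∷ is) = replicate (nextS ss n ∸ s) i ++ blocks n ss is
blocks n _ _ = []

termN : ℕ → List ℕ → List ℕ → List ℕ
termN n ss is = replicate (nextS ss n) 0 ++ blocks n ss is

-- coefficient of ∏_{j≤K} z_j^{e_j} in N_S (S = list s₁<⋯<s_m);
-- only 0 < i₁ < ⋯ < i_m ≤ K can contribute
coeffN : (n : ℕ) → List ℕ → (K : ℕ) → Vec ℕ (suc K) → ℕ
coeffN n S K e = countᵇ (λ is → matches K e (termN n S is)) (choose (length S) (oneTo K))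

coeffRHS : (n : ℕ) → Permutation′ n → (K : ℕ) → Vec ℕ (suc K) → ℕ
coeffRHS n π K e =
  sumℕ (map (λ E → if admissible n π E
                    then 2 ^ length (elems n E) * coeffN n (elems n E) K e
                    else 0)
           (tuples n (true ∷ false ∷ [])))

module Submission where

-- Group the words a counted by D^(ℓ)(π) by their profile t = (|a₁|, …, |aₙ|), on
-- which the monomial depends. As the order on P^(ℓ) refines the order of absolute
-- values, t is weakly increasing, hence the word of N_E for E the set of its block
-- starts (k ∈ E iff t_{k+1} > t_k, with t₀ = 0) and i₁ < ⋯ < i_m its nonzero values.
-- Inside a block of a nonzero value, an ascent forces the later letter to be positive
-- and a descent forces the earlier one to be negative; these constraints clash exactly
-- at a peak strictly inside the block, and otherwise leave one free sign per block.
-- In the block of zeros no descent is allowed, which excludes a peak anywhere but at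
-- its last letter. So a weakly increasing t has 2^|E| signings if lPe(π) ⊆ E ∪ (E+1)
-- and none otherwise; this count is proved by induction along t, keeping track of the
-- previous letter.

open import Defs
open import Data.Bool using (Bool; true; false; _∧_; _∨_; not; if_then_else_; T)
open import Data.Bool.Properties using (∧-comm; ∧-identityʳ; ∧-zeroʳ; ∨-zeroʳ; ∨-identityʳ; T-≡)
open import Data.Empty using (⊥-elim)
open import Data.Fin using (Fin; toℕ; fromℕ<)
open import Data.Fin.Permutation using (Permutation′; _⟨$⟩ʳ_)
open import Data.Fin.Properties using (toℕ-injective; toℕ-fromℕ<)
open import Data.Integer using (ℤ; +_; -[1+_]; ∣_∣)
open import Data.List using (List; []; _∷_; _++_; map; concatMap; length; upTo; replicate; drop)
open import Data.List.Properties using (length-map; map-upTo; concatMap-map)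
open import Data.List.Relation.Unary.All as All using (All; []; _∷_)
open import Data.List.Relation.Unary.All.Properties using (concat⁺; map⁺)
open import Data.List.Membership.Propositional.Properties using (∈-upTo⁻)
open import Data.Nat using (ℕ; zero; suc; _+_; _*_; _∸_; _^_; _<ᵇ_; _≡ᵇ_; _≤ᵇ_; _≤_; _<_; z≤n; s≤s; z<s)
open import Data.Nat.Properties
open import Algebra.Properties.CommutativeSemigroup +-commutativeSemigroup using (interchange)
open import Data.Vec using (Vec; lookup; allFin)
import Data.Vec as Vec
open import Data.Vec.Properties using (lookup-map; lookup-allFin)
open import Function using (_∘_; id; Equivalence)
open import Function.Bundles using (Injection)
open import Function.Properties.Inverse using (↔⇒↣)
open import Relation.Binary.Definitions using (tri<; tri≈; tri>)
open import Relation.Binary.PropositionalEquality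
  using (_≡_; _≢_; refl; sym; trans; cong; cong₂; subst; module ≡-Reasoning)
open import Relation.Nullary using (¬_)
open ≡-Reasoning

private
  variable
    A B : Set

∑ : (A → ℕ) → List A → ℕ
∑ f [] = 0
∑ f (x ∷ xs) = f x + ∑ f xs

syntax ∑ (λ x → e) xs = ∑[ x ∈ xs ] e

infixl 5 _when_
_when_ : ℕ → Bool → ℕ
m when b = if b then m else 0

𝟙 : Bool → ℕ
𝟙 b = 1 when b

∑-cong : ∀ {f g : A → ℕ} xs → (∀ x → f x ≡ g x) → ∑ f xs ≡ ∑ g xs
∑-cong [] h = refl
∑-cong (x ∷ xs) h = cong₂ _+_ (h x) (∑-cong xs h)

∑-congᴬ : ∀ {f g : A → ℕ} {xs} → All (λ x → f x ≡ g x) xs → ∑ f xs ≡ ∑ g xs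
∑-congᴬ [] = refl
∑-congᴬ (h ∷ hs) = cong₂ _+_ h (∑-congᴬ hs)

∑-zero : (xs : List A) → ∑[ x ∈ xs ] 0 ≡ 0
∑-zero [] = refl
∑-zero (x ∷ xs) = ∑-zero xs

∑-++ : ∀ (f : A → ℕ) xs ys → ∑ f (xs ++ ys) ≡ ∑ f xs + ∑ f ys
∑-++ f [] ys = refl
∑-++ f (x ∷ xs) ys = trans (cong (_+_ (f x)) (∑-++ f xs ys)) (sym (+-assoc (f x) _ _))

∑-map : ∀ (f : B → ℕ) (g : A → B) xs → ∑ f (map g xs) ≡ ∑ (f ∘ g) xs
∑-map f g [] = refl
∑-map f g (x ∷ xs) = cong (_+_ (f (g x))) (∑-map f g xs)

∑-concatMap : ∀ (f : B → ℕ) (g : A → List B) xs → ∑ f (concatMap g xs) ≡ ∑[ x ∈ xs ] ∑ f (g x)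
∑-concatMap f g [] = refl
∑-concatMap f g (x ∷ xs) =
  trans (∑-++ f (g x) (concatMap g xs)) (cong (_+_ (∑ f (g x))) (∑-concatMap f g xs))

∑-prepend : ∀ (f : List A → ℕ) ys zss →
  ∑ f (concatMap (λ y → map (y ∷_) zss) ys) ≡ ∑[ y ∈ ys ] ∑[ zs ∈ zss ] f (y ∷ zs)
∑-prepend f ys zss =
  trans (∑-concatMap f _ ys) (∑-cong ys (λ y → ∑-map f (y ∷_) zss))

∑-+ : ∀ (f g : A → ℕ) xs → ∑[ x ∈ xs ] (f x + g x) ≡ ∑ f xs + ∑ g xs
∑-+ f g [] = refl
∑-+ f g (x ∷ xs) = trans (cong (_+_ (f x + g x)) (∑-+ f g xs)) (interchange (f x) (g x) _ _)

∑-comm : ∀ (f : A → B → ℕ) xs ys → ∑[ x ∈ xs ] ∑[ y ∈ ys ] f x y ≡ ∑[ y ∈ ys ] ∑[ x ∈ xs ] f x y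
∑-comm f [] ys = sym (∑-zero ys)
∑-comm f (x ∷ xs) ys =
  trans (cong (_+_ (∑ (f x) ys)) (∑-comm f xs ys)) (sym (∑-+ (f x) _ ys))

∑-*ˡ : ∀ k (f : A → ℕ) xs → ∑[ x ∈ xs ] (k * f x) ≡ k * ∑ f xs
∑-*ˡ k f [] = sym (*-zeroʳ k)
∑-*ˡ k f (x ∷ xs) = trans (cong (_+_ (k * f x)) (∑-*ˡ k f xs)) (sym (*-distribˡ-+ k (f x) _))

∑-when : ∀ (f : A → ℕ) b xs → ∑[ x ∈ xs ] (f x when b) ≡ ∑ f xs when b
∑-when f true xs = refl
∑-when f false xs = ∑-zero xs

countᵇ≡∑𝟙 : ∀ (p : A → Bool) xs → countᵇ p xs ≡ ∑ (𝟙 ∘ p) xs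
countᵇ≡∑𝟙 p [] = refl
countᵇ≡∑𝟙 p (x ∷ xs) = cong (_+_ (𝟙 (p x))) (countᵇ≡∑𝟙 p xs)

sumℕ-map≡∑ : ∀ (f : A → ℕ) xs → sumℕ (map f xs) ≡ ∑ f xs
sumℕ-map≡∑ f [] = refl
sumℕ-map≡∑ f (x ∷ xs) = cong (_+_ (f x)) (sumℕ-map≡∑ f xs)

𝟙-∧ : ∀ a b → 𝟙 (a ∧ b) ≡ 𝟙 a when b
𝟙-∧ a true = cong 𝟙 (∧-identityʳ a)
𝟙-∧ a false = cong 𝟙 (∧-zeroʳ a)

when-comm : ∀ m a b → m when a when b ≡ m when b when a
when-comm m true b = refl
when-comm m false true = refl
when-comm m false false = refl

*-𝟙 : ∀ m b → m * 𝟙 b ≡ m when b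
*-𝟙 m true = *-identityʳ m
*-𝟙 m false = *-zeroʳ m

when-zero : ∀ b → 0 when b ≡ 0
when-zero true = refl
when-zero false = refl

*-countᵇ-when : ∀ k b (p : A → Bool) xs → k * countᵇ p xs when b ≡ ∑[ x ∈ xs ] (k when b when p x)
*-countᵇ-when k true p xs = begin
  k * countᵇ p xs       ≡⟨ cong (k *_) (countᵇ≡∑𝟙 p xs) ⟩
  k * ∑ (𝟙 ∘ p) xs      ≡⟨ ∑-*ˡ k (𝟙 ∘ p) xs ⟨
  ∑[ x ∈ xs ] (k * 𝟙 (p x))  ≡⟨ ∑-cong xs (λ x → *-𝟙 k (p x)) ⟩
  ∑[ x ∈ xs ] (k when p x)   ∎
*-countᵇ-when k false p xs = sym (trans (∑-cong xs (λ x → when-zero (p x))) (∑-zero xs))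

T⇒≡true : ∀ {b} → T b → b ≡ true
T⇒≡true = Equivalence.to T-≡

¬T⇒≡false : ∀ {b} → ¬ T b → b ≡ false
¬T⇒≡false {false} _ = refl
¬T⇒≡false {true} ¬t = ⊥-elim (¬t _)

<ᵇ-true : ∀ {m n} → m < n → (m <ᵇ n) ≡ true
<ᵇ-true m<n = T⇒≡true (<⇒<ᵇ m<n)

<ᵇ-false : ∀ {m n} → n ≤ m → (m <ᵇ n) ≡ false
<ᵇ-false {m} {n} n≤m = ¬T⇒≡false (λ t → <⇒≱ (<ᵇ⇒< m n t) n≤m)

≤ᵇ-true : ∀ {m n} → m ≤ n → (m ≤ᵇ n) ≡ true
≤ᵇ-true m≤n = T⇒≡true (≤⇒≤ᵇ m≤n)

≤ᵇ-false : ∀ {m n} → n < m → (m ≤ᵇ n) ≡ false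
≤ᵇ-false {m} {n} n<m = ¬T⇒≡false (λ t → <⇒≱ n<m (≤ᵇ⇒≤ m n t))

≡ᵇ-refl : ∀ m → (m ≡ᵇ m) ≡ true
≡ᵇ-refl m = T⇒≡true (≡⇒≡ᵇ m m refl)

≡ᵇ-false : ∀ {m n} → m ≢ n → (m ≡ᵇ n) ≡ false
≡ᵇ-false {m} {n} m≢n = ¬T⇒≡false (λ t → m≢n (≡ᵇ⇒≡ m n t))

<ᵇ-flip : ∀ {m n} → m ≢ n → (m <ᵇ n) ≡ not (n <ᵇ m)
<ᵇ-flip {m} {n} m≢n with <-cmp m n
... | tri< m<n _ _ rewrite <ᵇ-true m<n | <ᵇ-false (<⇒≤ m<n) = refl
... | tri≈ _ m≡n _ = ⊥-elim (m≢n m≡n)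
... | tri> _ _ n<m rewrite <ᵇ-true n<m | <ᵇ-false (<⇒≤ n<m) = refl

range : ℕ → ℕ → List ℕ
range a zero = []
range a (suc k) = a ∷ range (suc a) k

map-suc-range : ∀ a k → map suc (range a k) ≡ range (suc a) k
map-suc-range a zero = refl
map-suc-range a (suc k) = cong (suc a ∷_) (map-suc-range (suc a) k)

upTo-suc : ∀ k → upTo (suc k) ≡ 0 ∷ map suc (upTo k)
upTo-suc k = cong (0 ∷_) (sym (map-upTo suc k))

upTo≡range : ∀ k → upTo k ≡ range 0 k
upTo≡range zero = refl
upTo≡range (suc k) =
  trans (upTo-suc k) (cong (0 ∷_) (trans (cong (map suc) (upTo≡range k)) (map-suc-range 0 k)))

range-++ : ∀ a k l → range a (k + l) ≡ range a k ++ range (a + k) l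
range-++ a zero l rewrite +-identityʳ a = refl
range-++ a (suc k) l rewrite range-++ (suc a) k l | +-suc a k = refl

∑-range-cong : ∀ a k {f g : ℕ → ℕ} → (∀ x → a ≤ x → x < a + k → f x ≡ g x) →
  ∑ f (range a k) ≡ ∑ g (range a k)
∑-range-cong a zero h = refl
∑-range-cong a (suc k) h =
  cong₂ _+_ (h a ≤-refl (m<m+n a z<s))
    (∑-range-cong (suc a) k (λ x a<x x<a+k → h x (<⇒≤ a<x) (subst (x <_) (sym (+-suc a k)) x<a+k)))

-- Grouping words by their profile of absolute values

All-prepend : ∀ {P : List A → Set} ys zss →
  All (λ y → All (λ zs → P (y ∷ zs)) zss) ys → All P (concatMap (λ y → map (y ∷_) zss) ys)
All-prepend ys zss h = concat⁺ (map⁺ (All.map map⁺ h))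

length-tuples : ∀ n (X : List A) → All (λ t → length t ≡ n) (tuples n X)
length-tuples zero X = refl ∷ []
length-tuples (suc n) X =
  All-prepend X (tuples n X) (All.universal (λ _ → All.map (cong suc) (length-tuples n X)) X)

signs : ℕ → List ℤ
signs zero = + 0 ∷ []
signs (suc k) = -[1+ k ] ∷ + suc k ∷ []

signings : List ℕ → List (List ℤ)
signings [] = [] ∷ []
signings (x ∷ t) = concatMap (λ y → map (y ∷_) (signings t)) (signs x)

∣signs∣ : ∀ x → All (λ y → ∣ y ∣ ≡ x) (signs x)
∣signs∣ zero = refl ∷ []
∣signs∣ (suc x) = refl ∷ refl ∷ []

∣signings∣ : ∀ t → All (λ a → map ∣_∣ a ≡ t) (signings t)
∣signings∣ [] = refl ∷ []
∣signings∣ (x ∷ t) = All-prepend (signs x) (signings t)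
  (All.map (λ ∣y∣≡x → All.map (cong₂ _∷_ ∣y∣≡x) (∣signings∣ t)) (∣signs∣ x))

PℓUpTo≡concatMap-signs : ∀ K → PℓUpTo K ≡ concatMap signs (range 0 (suc K))
PℓUpTo≡concatMap-signs K = cong (+ 0 ∷_) (begin
  concatMap (signs ∘ suc) (upTo K)        ≡⟨ cong (concatMap (signs ∘ suc)) (upTo≡range K) ⟩
  concatMap (signs ∘ suc) (range 0 K)     ≡⟨ concatMap-map signs suc (range 0 K) ⟨
  concatMap signs (map suc (range 0 K))   ≡⟨ cong (concatMap signs) (map-suc-range 0 K) ⟩
  concatMap signs (range 1 K)             ∎)

∑-tuples-concatMap-signs : ∀ n (f : List ℤ → ℕ) L →
  ∑ f (tuples n (concatMap signs L)) ≡ ∑[ t ∈ tuples n L ] ∑ f (signings t)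
∑-tuples-concatMap-signs zero f L = cong (_+ 0) (sym (+-identityʳ (f [])))
∑-tuples-concatMap-signs (suc n) f L = begin
  ∑ f (tuples (suc n) P)
    ≡⟨ ∑-prepend f P (tuples n P) ⟩
  ∑[ y ∈ P ] ∑[ a ∈ tuples n P ] f (y ∷ a)
    ≡⟨ ∑-cong P (λ y → ∑-tuples-concatMap-signs n (f ∘ (y ∷_)) L) ⟩
  ∑[ y ∈ P ] ∑[ t ∈ tuples n L ] ∑[ a ∈ signings t ] f (y ∷ a)
    ≡⟨ ∑-concatMap _ signs L ⟩
  ∑[ x ∈ L ] ∑[ y ∈ signs x ] ∑[ t ∈ tuples n L ] ∑[ a ∈ signings t ] f (y ∷ a)
    ≡⟨ ∑-cong L (λ x → ∑-comm _ (signs x) (tuples n L)) ⟩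
  ∑[ x ∈ L ] ∑[ t ∈ tuples n L ] ∑[ y ∈ signs x ] ∑[ a ∈ signings t ] f (y ∷ a)
    ≡⟨ ∑-cong L (λ x → ∑-cong (tuples n L) (λ t → ∑-prepend f (signs x) (signings t))) ⟨
  ∑[ x ∈ L ] ∑[ t ∈ tuples n L ] ∑ f (signings (x ∷ t))
    ≡⟨ ∑-prepend (λ t → ∑ f (signings t)) L (tuples n L) ⟨
  ∑[ t ∈ tuples (suc n) L ] ∑ f (signings t) ∎
  where P = concatMap signs L

count-by-profile : ∀ n K (v : List ℤ → Bool) (r : List ℕ → Bool) →
  countᵇ (λ a → v a ∧ r (map ∣_∣ a)) (tuples n (PℓUpTo K))
  ≡ ∑[ t ∈ tuples n (range 0 (suc K)) ] (∑ (𝟙 ∘ v) (signings t) when r t)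
count-by-profile n K v r = begin
  countᵇ vr (tuples n (PℓUpTo K))
    ≡⟨ countᵇ≡∑𝟙 vr (tuples n (PℓUpTo K)) ⟩
  ∑ (𝟙 ∘ vr) (tuples n (PℓUpTo K))
    ≡⟨ cong (∑ (𝟙 ∘ vr) ∘ tuples n) (PℓUpTo≡concatMap-signs K) ⟩
  ∑ (𝟙 ∘ vr) (tuples n (concatMap signs (range 0 (suc K))))
    ≡⟨ ∑-tuples-concatMap-signs n (𝟙 ∘ vr) _ ⟩
  ∑[ t ∈ tuples n (range 0 (suc K)) ] ∑ (𝟙 ∘ vr) (signings t)
    ≡⟨ ∑-cong (tuples n _) count-in-profile ⟩
  ∑[ t ∈ tuples n (range 0 (suc K)) ] (∑ (𝟙 ∘ v) (signings t) when r t) ∎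
  where
  vr : List ℤ → Bool
  vr a = v a ∧ r (map ∣_∣ a)
  count-in-profile : ∀ t → ∑ (𝟙 ∘ vr) (signings t) ≡ ∑ (𝟙 ∘ v) (signings t) when r t
  count-in-profile t = trans
    (∑-congᴬ (All.map (λ {a} ∣a∣≡t → trans (cong (𝟙 ∘ (v a ∧_) ∘ r) ∣a∣≡t) (𝟙-∧ (v a) (r t))) (∣signings∣ t)))
    (∑-when (𝟙 ∘ v) (r t) (signings t))

-- Counting the signings of a profile

rises : ℕ → List ℕ → List Bool
rises c [] = []
rises c (x ∷ t) = (c <ᵇ x) ∷ rises x t

nondecreasingFrom : ℕ → List ℕ → Bool
nondecreasingFrom c [] = true
nondecreasingFrom c (x ∷ t) = (c ≤ᵇ x) ∧ nondecreasingFrom x t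

length-rises : ∀ c t → length (rises c t) ≡ length t
length-rises c [] = refl
length-rises c (x ∷ t) = cong suc (length-rises x t)

allᵇ-map : ∀ (p : B → Bool) (f : A → B) xs → allᵇ p (map f xs) ≡ allᵇ (p ∘ f) xs
allᵇ-map p f [] = refl
allᵇ-map p f (x ∷ xs) = cong (p (f x) ∧_) (allᵇ-map p f xs)

allᵇ-congᴬ : ∀ {p q : A → Bool} {xs} → All (λ x → p x ≡ q x) xs → allᵇ p xs ≡ allᵇ q xs
allᵇ-congᴬ [] = refl
allᵇ-congᴬ (h ∷ hs) = cong₂ _∧_ h (allᵇ-congᴬ hs)

leqAt : Bool → ℤ → ℤ → Bool
leqAt descent y z = if descent then leq⁻ y z else leq⁺ y z

-- validD n π is valid (isDes n π) _ (n ∸ 1).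
valid : (ℕ → Bool) → List ℤ → ℕ → Bool
valid d a m = allᵇ (λ s → leqAt (d s) (nth (+ 0) a s) (nth (+ 0) a (suc s))) (oneTo m)

valid-∷∷ : ∀ d y z r m → valid d (y ∷ z ∷ r) (suc m) ≡ leqAt (d 1) y z ∧ valid (d ∘ suc) (z ∷ r) m
valid-∷∷ d y z r m = begin
  allᵇ p (map suc (upTo (suc m)))
    ≡⟨ cong (allᵇ p ∘ map suc) (upTo-suc m) ⟩
  p 1 ∧ allᵇ p (map suc (map suc (upTo m)))
    ≡⟨ cong (p 1 ∧_) (allᵇ-map p suc (map suc (upTo m))) ⟩
  p 1 ∧ allᵇ (p ∘ suc) (map suc (upTo m))
    ≡⟨ cong (p 1 ∧_) (allᵇ-map (p ∘ suc) suc (upTo m)) ⟩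
  p 1 ∧ allᵇ (p ∘ suc ∘ suc) (upTo m)
    ≡⟨ cong (p 1 ∧_) (allᵇ-map _ suc (upTo m)) ⟨
  leqAt (d 1) y z ∧ valid (d ∘ suc) (z ∷ r) m ∎
  where
  p : ℕ → Bool
  p s = leqAt (d s) (nth (+ 0) (y ∷ z ∷ r) s) (nth (+ 0) (y ∷ z ∷ r) (suc s))

extensions : (ℕ → Bool) → ℤ → List ℕ → ℕ
extensions d y t = ∑[ a ∈ signings t ] 𝟙 (valid d (y ∷ a) (length t))

extensions-∷ : ∀ d y x t →
  extensions d y (x ∷ t) ≡ ∑[ z ∈ signs x ] (extensions (d ∘ suc) z t when leqAt (d 1) y z)
extensions-∷ d y x t = begin
  extensions d y (x ∷ t)
    ≡⟨ ∑-prepend (λ a → 𝟙 (valid d (y ∷ a) (suc (length t)))) (signs x) (signings t) ⟩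
  ∑[ z ∈ signs x ] ∑[ r ∈ signings t ] 𝟙 (valid d (y ∷ z ∷ r) (suc (length t)))
    ≡⟨ ∑-cong (signs x) (λ z → ∑-cong (signings t) (λ r →
         trans (cong 𝟙 (trans (valid-∷∷ d y z r (length t)) (∧-comm (leqAt (d 1) y z) _)))
               (𝟙-∧ (valid (d ∘ suc) (z ∷ r) (length t)) (leqAt (d 1) y z)))) ⟩
  ∑[ z ∈ signs x ] ∑[ r ∈ signings t ] (𝟙 (valid (d ∘ suc) (z ∷ r) (length t)) when leqAt (d 1) y z)
    ≡⟨ ∑-cong (signs x) (λ z → ∑-when _ (leqAt (d 1) y z) (signings t)) ⟩
  ∑[ z ∈ signs x ] (extensions (d ∘ suc) z t when leqAt (d 1) y z) ∎

2[1+k]≡2k+2 : ∀ k → 2 * suc k ≡ 2 * k + 2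
2[1+k]≡2k+2 k = trans (*-suc 2 k) (+-comm 2 (2 * k))

key≤2∣∣ : ∀ y → key y ≤ 2 * ∣ y ∣
key≤2∣∣ (+ zero) = z≤n
key≤2∣∣ (+ suc k) = ≤-reflexive (sym (2[1+k]≡2k+2 k))
key≤2∣∣ -[1+ k ] = ≤-trans (n≤1+n (2 * k + 1))
  (≤-reflexive (trans (sym (+-suc (2 * k) 1)) (sym (2[1+k]≡2k+2 k))))

2∣∣≤1+key : ∀ y → 2 * ∣ y ∣ ≤ suc (key y)
2∣∣≤1+key (+ zero) = z≤n
2∣∣≤1+key (+ suc k) = ≤-trans (≤-reflexive (2[1+k]≡2k+2 k)) (n≤1+n _)
2∣∣≤1+key -[1+ k ] = ≤-reflexive (trans (2[1+k]≡2k+2 k) (+-suc (2 * k) 1))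

key-mono : ∀ y z → ∣ y ∣ < ∣ z ∣ → key y < key z
key-mono y z ∣y∣<∣z∣ = ≤-pred (≤-trans (s≤s (s≤s (key≤2∣∣ y)))
  (≤-trans (≤-reflexive (sym (*-suc 2 ∣ y ∣))) (≤-trans (*-monoʳ-≤ 2 ∣y∣<∣z∣) (2∣∣≤1+key z))))

key-neg<key-pos : ∀ c → key -[1+ c ] < key (+ suc c)
key-neg<key-pos c = ≤-reflexive (sym (+-suc (2 * c) 1))

leqAt-< : ∀ b y z → key y < key z → leqAt b y z ≡ true
leqAt-< true y z lt rewrite <ᵇ-true lt = refl
leqAt-< false y z lt rewrite <ᵇ-true lt = refl

leqAt-> : ∀ b y z → key z < key y → leqAt b y z ≡ false
leqAt-> true y z gt rewrite <ᵇ-false (<⇒≤ gt) | ≡ᵇ-false (>⇒≢ gt) = refl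
leqAt-> false y z gt rewrite <ᵇ-false (<⇒≤ gt) | ≡ᵇ-false (>⇒≢ gt) = refl

leqAt-refl : ∀ b y → leqAt b y y ≡ (if b then not (nonneg y) else nonneg y)
leqAt-refl true y rewrite <ᵇ-false (≤-refl {key y}) | ≡ᵇ-refl (key y) = refl
leqAt-refl false y rewrite <ᵇ-false (≤-refl {key y}) | ≡ᵇ-refl (key y) = refl

∑-signs-below : ∀ b y x (g : ℤ → ℕ) → x < ∣ y ∣ → ∑[ z ∈ signs x ] (g z when leqAt b y z) ≡ 0
∑-signs-below b y zero g lt = cong (λ β → (g (+ 0) when β) + 0) (leqAt-> b y (+ 0) (key-mono (+ 0) y lt))
∑-signs-below b y (suc x) g lt = cong₂ (λ β γ → (g -[1+ x ] when β) + ((g (+ suc x) when γ) + 0))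
  (leqAt-> b y -[1+ x ] (key-mono -[1+ x ] y lt)) (leqAt-> b y (+ suc x) (key-mono (+ suc x) y lt))

∑-signs-above : ∀ b y x (g : ℤ → ℕ) → ∣ y ∣ < x → ∑[ z ∈ signs x ] (g z when leqAt b y z) ≡ ∑ g (signs x)
∑-signs-above b y (suc x) g lt = cong₂ (λ β γ → (g -[1+ x ] when β) + ((g (+ suc x) when γ) + 0))
  (leqAt-< b y -[1+ x ] (key-mono y -[1+ x ] lt)) (leqAt-< b y (+ suc x) (key-mono y (+ suc x) lt))

∑-signs-after-positive : ∀ b c (g : ℤ → ℕ) →
  ∑[ z ∈ signs c ] (g z when leqAt b (+ c) z) ≡ g (+ c) when not b
∑-signs-after-positive true zero g = refl
∑-signs-after-positive false zero g = +-identityʳ _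
∑-signs-after-positive true (suc c) g =
  cong₂ (λ β γ → (g -[1+ c ] when β) + ((g (+ suc c) when γ) + 0))
    (leqAt-> true (+ suc c) -[1+ c ] (key-neg<key-pos c)) (leqAt-refl true (+ suc c))
∑-signs-after-positive false (suc c) g =
  trans (cong₂ (λ β γ → (g -[1+ c ] when β) + ((g (+ suc c) when γ) + 0))
    (leqAt-> false (+ suc c) -[1+ c ] (key-neg<key-pos c)) (leqAt-refl false (+ suc c))) (+-identityʳ _)

∑-signs-after-negative : ∀ b c (g : ℤ → ℕ) →
  ∑[ z ∈ signs (suc c) ] (g z when leqAt b -[1+ c ] z) ≡ (g -[1+ c ] when b) + g (+ suc c)
∑-signs-after-negative true c g =
  trans (cong₂ (λ β γ → (g -[1+ c ] when β) + ((g (+ suc c) when γ) + 0))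
    (leqAt-refl true -[1+ c ]) (leqAt-< true -[1+ c ] (+ suc c) (key-neg<key-pos c)))
    (cong (_+_ (g -[1+ c ])) (+-identityʳ _))
∑-signs-after-negative false c g =
  trans (cong₂ (λ β γ → (g -[1+ c ] when β) + ((g (+ suc c) when γ) + 0))
    (leqAt-refl false -[1+ c ]) (leqAt-< false -[1+ c ] (+ suc c) (key-neg<key-pos c))) (+-identityʳ _)

extensions-below : ∀ d y x t → x < ∣ y ∣ → extensions d y (x ∷ t) ≡ 0
extensions-below d y x t lt =
  trans (extensions-∷ d y x t) (∑-signs-below (d 1) y x (λ z → extensions (d ∘ suc) z t) lt)

extensions-above : ∀ d y x t → ∣ y ∣ < x →
  extensions d y (x ∷ t) ≡ ∑[ z ∈ signs x ] extensions (d ∘ suc) z t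
extensions-above d y x t lt =
  trans (extensions-∷ d y x t) (∑-signs-above (d 1) y x (λ z → extensions (d ∘ suc) z t) lt)

extensions-after-positive : ∀ d c t →
  extensions d (+ c) (c ∷ t) ≡ extensions (d ∘ suc) (+ c) t when not (d 1)
extensions-after-positive d c t =
  trans (extensions-∷ d (+ c) c t) (∑-signs-after-positive (d 1) c (λ z → extensions (d ∘ suc) z t))

extensions-after-negative : ∀ d c t →
  extensions d -[1+ c ] (suc c ∷ t)
  ≡ (extensions (d ∘ suc) -[1+ c ] t when d 1) + extensions (d ∘ suc) (+ suc c) t
extensions-after-negative d c t =
  trans (extensions-∷ d -[1+ c ] (suc c) t) (∑-signs-after-negative (d 1) c (λ z → extensions (d ∘ suc) z t))

peak : (ℕ → Bool) → ℕ → Bool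
peak d i = d i ∧ not (d (i ∸ 1))

-- Positions i = 1, …, m, bits of E numbered from 0.
admissibleFrom : (ℕ → Bool) → List Bool → ℕ → Bool
admissibleFrom P E m = allᵇ (λ i → if P (suc i) then memb E (suc i) ∨ memb E i else true) (upTo m)

admissibleFrom-suc : ∀ P E m → admissibleFrom P E (suc m)
  ≡ (if P 1 then memb E 1 ∨ memb E 0 else true) ∧ admissibleFrom (P ∘ suc) (drop 1 E) m
admissibleFrom-suc P E m =
  trans (cong (allᵇ p) (upTo-suc m)) (cong (p 0 ∧_) (trans (allᵇ-map p suc (upTo m)) (drop-head E)))
  where
  p : ℕ → Bool
  p i = if P (suc i) then memb E (suc i) ∨ memb E i else true
  drop-head : ∀ E → allᵇ (λ i → if P (suc (suc i)) then memb E (suc (suc i)) ∨ memb E (suc i) else true) (upTo m)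
                    ≡ admissibleFrom (P ∘ suc) (drop 1 E) m
  drop-head [] = refl
  drop-head (_ ∷ _) = refl

-- The predicted number of signings of the rest t of a profile, after a letter of
-- absolute value c whose position has bit b in E.
weight : (ℕ → Bool) → ℕ → Bool → List ℕ → ℕ
weight d c b t =
  2 ^ countᵇ id (rises c t) when admissibleFrom (peak d) (b ∷ rises c t) (length t)
                            when nondecreasingFrom c t

*-when-∧ : ∀ N M p q h a → N * M when (h ∧ a) when (p ∧ q) ≡ N * (M when a when q) when h when p
*-when-∧ N M false q h a = refl
*-when-∧ N M true false false a = refl
*-when-∧ N M true false true a = sym (*-zeroʳ N)
*-when-∧ N M true true false a = refl
*-when-∧ N M true true true false = sym (*-zeroʳ N)
*-when-∧ N M true true true true = refl

weight-∷ : ∀ d c b x t → weight d c b (x ∷ t)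
  ≡ 2 ^ 𝟙 (c <ᵇ x) * weight (d ∘ suc) x (c <ᵇ x) t when (if peak d 1 then (c <ᵇ x) ∨ b else true)
                                                  when (c ≤ᵇ x)
weight-∷ d c b x t = begin
  2 ^ (𝟙 r + countᵇ id R) when admissibleFrom (peak d) (b ∷ r ∷ R) (suc (length t)) when (c ≤ᵇ x) ∧ q
    ≡⟨ cong (λ a → 2 ^ (𝟙 r + countᵇ id R) when a when (c ≤ᵇ x) ∧ q)
         (admissibleFrom-suc (peak d) (b ∷ r ∷ R) (length t)) ⟩
  2 ^ (𝟙 r + countᵇ id R) when h ∧ a when (c ≤ᵇ x) ∧ q
    ≡⟨ cong (λ k → k when h ∧ a when (c ≤ᵇ x) ∧ q) (^-distribˡ-+-* 2 (𝟙 r) (countᵇ id R)) ⟩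
  2 ^ 𝟙 r * 2 ^ countᵇ id R when h ∧ a when (c ≤ᵇ x) ∧ q
    ≡⟨ *-when-∧ (2 ^ 𝟙 r) (2 ^ countᵇ id R) (c ≤ᵇ x) q h a ⟩
  2 ^ 𝟙 r * weight (d ∘ suc) x r t when h when (c ≤ᵇ x) ∎
  where
  r = c <ᵇ x
  R = rises x t
  q = nondecreasingFrom x t
  h = if peak d 1 then r ∨ b else true
  a = admissibleFrom (peak (d ∘ suc)) (r ∷ R) (length t)

weight-below : ∀ d c b x t → x < c → weight d c b (x ∷ t) ≡ 0
weight-below d c b x t x<c rewrite weight-∷ d c b x t | ≤ᵇ-false x<c = refl

weight-above : ∀ d c b x t → c < x → weight d c b (x ∷ t) ≡ 2 * weight (d ∘ suc) x true t
weight-above d c b x t c<x rewrite weight-∷ d c b x t | ≤ᵇ-true (<⇒≤ c<x) | <ᵇ-true c<x with peak d 1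
... | true = refl
... | false = refl

weight-level : ∀ d c b t →
  weight d c b (c ∷ t) ≡ weight (d ∘ suc) c false t when (if peak d 1 then b else true)
weight-level d c b t rewrite weight-∷ d c b c t | ≤ᵇ-true (≤-refl {c}) | <ᵇ-false (≤-refl {c}) =
  cong (_when (if peak d 1 then b else true)) (+-identityʳ _)

weight-level-descent : ∀ d c b t → d 1 ≡ true → (d 0 ∨ b) ≡ true →
  weight d c b (c ∷ t) ≡ weight (d ∘ suc) c false t
weight-level-descent d c b t d1 h =
  trans (weight-level d c b t) (cong (weight (d ∘ suc) c false t when_) (peak-covered (d 0) (d 1) b d1 h))
  where
  peak-covered : ∀ d0 d1 b → d1 ≡ true → (d0 ∨ b) ≡ true → (if d1 ∧ not d0 then b else true) ≡ true
  peak-covered true _ _ refl _ = refl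
  peak-covered false _ _ refl b≡true = b≡true

weight-level-ascent : ∀ d c b t → d 1 ≡ false → weight d c b (c ∷ t) ≡ weight (d ∘ suc) c false t
weight-level-ascent d c b t d1 =
  trans (weight-level d c b t)
    (cong (λ β → weight (d ∘ suc) c false t when (if β ∧ not (d 0) then b else true)) d1)

∑-signs-extensions-descent : ∀ d c t → d 1 ≡ true →
  ∑[ y ∈ signs (suc c) ] extensions d y (suc c ∷ t) ≡ ∑[ y ∈ signs (suc c) ] extensions (d ∘ suc) y t
∑-signs-extensions-descent d c t d1 = begin
  ∑[ y ∈ signs (suc c) ] extensions d y (suc c ∷ t)
    ≡⟨ cong₂ (λ u v → u + (v + 0)) (extensions-after-negative d c t) (extensions-after-positive d (suc c) t) ⟩
  (g -[1+ c ] when d 1) + g (+ suc c) + ((g (+ suc c) when not (d 1)) + 0)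
    ≡⟨ cong (λ β → (g -[1+ c ] when β) + g (+ suc c) + ((g (+ suc c) when not β) + 0)) d1 ⟩
  g -[1+ c ] + g (+ suc c) + 0
    ≡⟨ trans (+-identityʳ _) (cong (_+_ (g -[1+ c ])) (sym (+-identityʳ _))) ⟩
  ∑ g (signs (suc c)) ∎
  where
  g : ℤ → ℕ
  g z = extensions (d ∘ suc) z t

∑-signs-extensions-ascent : ∀ d c t → d 1 ≡ false →
  ∑[ y ∈ signs (suc c) ] extensions d y (suc c ∷ t) ≡ 2 * extensions (d ∘ suc) (+ suc c) t
∑-signs-extensions-ascent d c t d1 =
  trans (cong₂ (λ u v → u + (v + 0)) (extensions-after-negative d c t) (extensions-after-positive d (suc c) t))
    (cong (λ β → (g -[1+ c ] when β) + g (+ suc c) + ((g (+ suc c) when not β) + 0)) d1)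
  where
  g : ℤ → ℕ
  g z = extensions (d ∘ suc) z t

mutual
  ∑-signs-extensions : ∀ t d c b → (d 0 ∨ b) ≡ true →
    ∑[ y ∈ signs (suc c) ] extensions d y t ≡ 2 * weight d (suc c) b t
  ∑-signs-extensions [] d c b _ = refl
  ∑-signs-extensions (x ∷ t) d c b h with <-cmp x (suc c)
  ... | tri< x<c _ _ = begin
    ∑[ y ∈ signs (suc c) ] extensions d y (x ∷ t)
      ≡⟨ ∑-congᴬ (All.map (λ {y} ∣y∣≡ → extensions-below d y x t (subst (x <_) (sym ∣y∣≡) x<c))
                          (∣signs∣ (suc c))) ⟩
    0
      ≡⟨ cong (2 *_) (weight-below d (suc c) b x t x<c) ⟨
    2 * weight d (suc c) b (x ∷ t) ∎
  ... | tri> _ _ c<x = above x c<x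
    where
    above : ∀ x → suc c < x → ∑[ y ∈ signs (suc c) ] extensions d y (x ∷ t) ≡ 2 * weight d (suc c) b (x ∷ t)
    above (suc x) c<x = begin
      ∑[ y ∈ signs (suc c) ] extensions d y (suc x ∷ t)
        ≡⟨ ∑-congᴬ (All.map (λ {y} ∣y∣≡ → extensions-above d y (suc x) t (subst (_< suc x) (sym ∣y∣≡) c<x))
                            (∣signs∣ (suc c))) ⟩
      ∑[ y ∈ signs (suc c) ] ∑[ z ∈ signs (suc x) ] extensions (d ∘ suc) z t
        ≡⟨ ∑-cong (signs (suc c)) (λ _ → ∑-signs-extensions t (d ∘ suc) x true (∨-zeroʳ (d 1))) ⟩
      2 * (2 * weight (d ∘ suc) (suc x) true t)
        ≡⟨ cong (2 *_) (weight-above d (suc c) b (suc x) t c<x) ⟨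
      2 * weight d (suc c) b (suc x ∷ t) ∎
  ... | tri≈ _ refl _ = level (d 1) refl
    where
    level : ∀ β → d 1 ≡ β →
      ∑[ y ∈ signs (suc c) ] extensions d y (suc c ∷ t) ≡ 2 * weight d (suc c) b (suc c ∷ t)
    level true d1 = begin
      ∑[ y ∈ signs (suc c) ] extensions d y (suc c ∷ t)
        ≡⟨ ∑-signs-extensions-descent d c t d1 ⟩
      ∑[ y ∈ signs (suc c) ] extensions (d ∘ suc) y t
        ≡⟨ ∑-signs-extensions t (d ∘ suc) c false (trans (∨-identityʳ (d 1)) d1) ⟩
      2 * weight (d ∘ suc) (suc c) false t
        ≡⟨ cong (2 *_) (weight-level-descent d (suc c) b t d1 h) ⟨
      2 * weight d (suc c) b (suc c ∷ t) ∎
    level false d1 = begin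
      ∑[ y ∈ signs (suc c) ] extensions d y (suc c ∷ t)
        ≡⟨ ∑-signs-extensions-ascent d c t d1 ⟩
      2 * extensions (d ∘ suc) (+ suc c) t
        ≡⟨ cong (2 *_) (extensions-positive t (d ∘ suc) (suc c) d1) ⟩
      2 * weight (d ∘ suc) (suc c) false t
        ≡⟨ cong (2 *_) (weight-level-ascent d (suc c) b t d1) ⟨
      2 * weight d (suc c) b (suc c ∷ t) ∎

  extensions-positive : ∀ t d c → d 0 ≡ false → extensions d (+ c) t ≡ weight d c false t
  extensions-positive [] d c _ = refl
  extensions-positive (x ∷ t) d c h with <-cmp x c
  ... | tri< x<c _ _ = trans (extensions-below d (+ c) x t x<c) (sym (weight-below d c false x t x<c))
  ... | tri> _ _ c<x = above x c<x
    where
    above : ∀ x → c < x → extensions d (+ c) (x ∷ t) ≡ weight d c false (x ∷ t)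
    above (suc x) c<x = begin
      extensions d (+ c) (suc x ∷ t)
        ≡⟨ extensions-above d (+ c) (suc x) t c<x ⟩
      ∑[ z ∈ signs (suc x) ] extensions (d ∘ suc) z t
        ≡⟨ ∑-signs-extensions t (d ∘ suc) x true (∨-zeroʳ (d 1)) ⟩
      2 * weight (d ∘ suc) (suc x) true t
        ≡⟨ weight-above d c false (suc x) t c<x ⟨
      weight d c false (suc x ∷ t) ∎
  ... | tri≈ _ refl _ = level (d 1) refl
    where
    level : ∀ β → d 1 ≡ β → extensions d (+ c) (c ∷ t) ≡ weight d c false (c ∷ t)
    level true d1 rewrite extensions-after-positive d c t | weight-level d c false t | d1 | h = refl
    level false d1 = begin
      extensions d (+ c) (c ∷ t)                ≡⟨ extensions-after-positive d c t ⟩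
      extensions (d ∘ suc) (+ c) t when not (d 1) ≡⟨ cong ((extensions (d ∘ suc) (+ c) t when_) ∘ not) d1 ⟩
      extensions (d ∘ suc) (+ c) t              ≡⟨ extensions-positive t (d ∘ suc) c d1 ⟩
      weight (d ∘ suc) c false t                ≡⟨ weight-level-ascent d c false t d1 ⟨
      weight d c false (c ∷ t)                  ∎

-- The virtual letter + 0 in front, like π(0) = 0, imposes nothing: + 0 ≤⁺ z for all z.
extensions-origin : ∀ d t → d 0 ≡ false →
  ∑[ a ∈ signings t ] 𝟙 (valid d a (length t ∸ 1)) ≡ extensions (λ i → d (i ∸ 1)) (+ 0) t
extensions-origin d [] _ = refl
extensions-origin d (zero ∷ t) d0 = begin
  ∑[ a ∈ signings (0 ∷ t) ] 𝟙 (valid d a (length t))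
    ≡⟨ ∑-prepend (λ a → 𝟙 (valid d a (length t))) (signs 0) (signings t) ⟩
  extensions d (+ 0) t + 0
    ≡⟨ +-identityʳ _ ⟩
  extensions d (+ 0) t
    ≡⟨ cong ((extensions d (+ 0) t when_) ∘ not) d0 ⟨
  extensions d (+ 0) t when not (d 0)
    ≡⟨ extensions-after-positive (λ i → d (i ∸ 1)) 0 t ⟨
  extensions (λ i → d (i ∸ 1)) (+ 0) (0 ∷ t) ∎
extensions-origin d (suc x ∷ t) _ =
  trans (∑-prepend (λ a → 𝟙 (valid d a (length t))) (signs (suc x)) (signings t))
    (sym (extensions-above (λ i → d (i ∸ 1)) (+ 0) (suc x) t z<s))

-- Weakly increasing profiles as the words of the N_E

filterᵇ-map : ∀ (p : B → Bool) (f : A → B) xs → filterᵇ p (map f xs) ≡ map f (filterᵇ (p ∘ f) xs)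
filterᵇ-map p f [] = refl
filterᵇ-map p f (x ∷ xs) with p (f x)
... | true = cong (f x ∷_) (filterᵇ-map p f xs)
... | false = filterᵇ-map p f xs

elems-∷ : ∀ n b E → elems (suc n) (b ∷ E) ≡ (if b then 0 ∷ map suc (elems n E) else map suc (elems n E))
elems-∷ n b E = trans (cong (filterᵇ (memb (b ∷ E))) (upTo-suc n))
  (cong (λ l → if b then 0 ∷ l else l) (filterᵇ-map (memb (b ∷ E)) suc (upTo n)))

length-elems : ∀ n E → length E ≡ n → length (elems n E) ≡ countᵇ id E
length-elems zero [] _ = refl
length-elems (suc n) (b ∷ E) len = trans (cong length (elems-∷ n b E)) (count b)
  where
  IH = trans (length-map suc (elems n E)) (length-elems n E (suc-injective len))
  count : ∀ b → length (if b then 0 ∷ map suc (elems n E) else map suc (elems n E)) ≡ 𝟙 b + countᵇ id E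
  count true = cong suc IH
  count false = IH

termNFrom : ℕ → ℕ → List ℕ → List ℕ → List ℕ
termNFrom c n S is = replicate (nextS S n) c ++ blocks n S is

nextS-map-suc : ∀ S n → nextS (map suc S) (suc n) ≡ suc (nextS S n)
nextS-map-suc [] n = refl
nextS-map-suc (_ ∷ _) n = refl

blocks-map-suc : ∀ n S is → blocks (suc n) (map suc S) is ≡ blocks n S is
blocks-map-suc n [] is = refl
blocks-map-suc n (s ∷ S) [] = refl
blocks-map-suc n (s ∷ S) (i ∷ is) rewrite nextS-map-suc S n =
  cong (replicate (nextS S n ∸ s) i ++_) (blocks-map-suc n S is)

termNFrom-shift : ∀ c n S is → termNFrom c (suc n) (map suc S) is ≡ c ∷ termNFrom c n S is
termNFrom-shift c n S is rewrite nextS-map-suc S n | blocks-map-suc n S is = refl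

-- ∑ᵗ a k g sums g x r over a ≤ x < a + k, where r = a + k - 1 - x is the
-- number of elements of the range after x.
∑ᵗ : ℕ → ℕ → (ℕ → ℕ → ℕ) → ℕ
∑ᵗ a zero g = 0
∑ᵗ a (suc k) g = g a k + ∑ᵗ (suc a) k g

∑ᵗ-cong : ∀ a k {g h : ℕ → ℕ → ℕ} → (∀ x r → x + suc r ≡ a + k → g x r ≡ h x r) → ∑ᵗ a k g ≡ ∑ᵗ a k h
∑ᵗ-cong a zero _ = refl
∑ᵗ-cong a (suc k) eq =
  cong₂ _+_ (eq a k refl) (∑ᵗ-cong (suc a) k (λ x r x+1+r≡ → eq x r (trans x+1+r≡ (sym (+-suc a k)))))

∑ᵗ-const : ∀ a k (h : ℕ → ℕ) → ∑ᵗ a k (λ x _ → h x) ≡ ∑ h (range a k)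
∑ᵗ-const a zero h = refl
∑ᵗ-const a (suc k) h = cong (_+_ (h a)) (∑ᵗ-const (suc a) k h)

∑-∑ᵗ-comm : ∀ (ys : List A) a k (g : A → ℕ → ℕ → ℕ) →
  ∑[ y ∈ ys ] ∑ᵗ a k (g y) ≡ ∑ᵗ a k (λ x r → ∑[ y ∈ ys ] g y x r)
∑-∑ᵗ-comm ys a zero g = ∑-zero ys
∑-∑ᵗ-comm ys a (suc k) g =
  trans (∑-+ (λ y → g y a k) (λ y → ∑ᵗ (suc a) k (g y)) ys) (cong (_+_ _) (∑-∑ᵗ-comm ys (suc a) k g))

∑-choose-suc : ∀ (G : List ℕ → ℕ) m a k →
  ∑ G (choose (suc m) (range a k)) ≡ ∑ᵗ a k (λ x r → ∑[ is ∈ choose m (range (suc x) r) ] G (x ∷ is))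
∑-choose-suc G m a zero = refl
∑-choose-suc G m a (suc k) = trans (∑-++ G (map (a ∷_) (choose m (range (suc a) k))) _)
  (cong₂ _+_ (∑-map G (a ∷_) (choose m (range (suc a) k))) (∑-choose-suc G m (suc a) k))

bits : List Bool
bits = true ∷ false ∷ []

after : Bool → ℕ → (List Bool → List ℕ → ℕ) → List Bool → List ℕ → ℕ
after b x F E t = F (b ∷ E) (x ∷ t)

-- Σ_E Σ_{c < i₁ < ⋯ < i_m ≤ c + k} F E w, w the word of N_E with z_0 read as z_c.
blockSum : ℕ → ℕ → ℕ → (List Bool → List ℕ → ℕ) → ℕ
blockSum n c k F =
  ∑[ E ∈ tuples n bits ] ∑[ is ∈ choose (length (elems n E)) (range (suc c) k) ]
    F E (termNFrom c n (elems n E) is)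

monotoneSum : ℕ → ℕ → ℕ → (List Bool → List ℕ → ℕ) → ℕ
monotoneSum n c K F = ∑[ t ∈ tuples n (range 0 (suc K)) ] (F (rises c t) t when nondecreasingFrom c t)

blockSum-suc : ∀ n c k F → blockSum (suc n) c k F
  ≡ blockSum n c k (after false c F) + ∑ᵗ (suc c) k (λ x r → blockSum n x r (after true x F))
blockSum-suc n c k F = begin
  ∑ inner (tuples (suc n) bits)
    ≡⟨ ∑-prepend inner bits (tuples n bits) ⟩
  ∑[ E ∈ tuples n bits ] inner (true ∷ E) + (∑[ E ∈ tuples n bits ] inner (false ∷ E) + 0)
    ≡⟨ cong₂ (λ u v → u + (v + 0)) (∑-cong (tuples n bits) new-block) (∑-cong (tuples n bits) same-block) ⟩
  ∑[ E ∈ tuples n bits ] ∑ᵗ (suc c) k (λ x r → blocks-from x r E) + (blockSum n c k (after false c F) + 0)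
    ≡⟨ cong₂ _+_ (∑-∑ᵗ-comm (tuples n bits) (suc c) k (λ E x r → blocks-from x r E)) (+-identityʳ _) ⟩
  ∑ᵗ (suc c) k (λ x r → blockSum n x r (after true x F)) + blockSum n c k (after false c F)
    ≡⟨ +-comm (∑ᵗ (suc c) k (λ x r → blockSum n x r (after true x F))) (blockSum n c k (after false c F)) ⟩
  blockSum n c k (after false c F) + ∑ᵗ (suc c) k (λ x r → blockSum n x r (after true x F)) ∎
  where
  with-elems : List Bool → List ℕ → ℕ
  with-elems E S = ∑[ is ∈ choose (length S) (range (suc c) k) ] F E (termNFrom c (suc n) S is)
  inner : List Bool → ℕ
  inner E = with-elems E (elems (suc n) E)
  blocks-from : ℕ → ℕ → List Bool → ℕ
  blocks-from x r E = ∑[ is ∈ choose (length (elems n E)) (range (suc x) r) ]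
                        F (true ∷ E) (x ∷ termNFrom x n (elems n E) is)
  same-block : ∀ E → inner (false ∷ E)
    ≡ ∑[ is ∈ choose (length (elems n E)) (range (suc c) k) ] F (false ∷ E) (c ∷ termNFrom c n (elems n E) is)
  same-block E = begin
    with-elems (false ∷ E) (elems (suc n) (false ∷ E))
      ≡⟨ cong (with-elems (false ∷ E)) (elems-∷ n false E) ⟩
    ∑[ is ∈ choose (length S) (range (suc c) k) ] F (false ∷ E) (termNFrom c (suc n) S is)
      ≡⟨ cong (λ m → ∑[ is ∈ choose m (range (suc c) k) ] F (false ∷ E) (termNFrom c (suc n) S is))
              (length-map suc (elems n E)) ⟩
    ∑[ is ∈ choose (length (elems n E)) (range (suc c) k) ] F (false ∷ E) (termNFrom c (suc n) S is)
      ≡⟨ ∑-cong (choose (length (elems n E)) (range (suc c) k))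
              (λ is → cong (F (false ∷ E)) (termNFrom-shift c n (elems n E) is)) ⟩
    ∑[ is ∈ choose (length (elems n E)) (range (suc c) k) ] F (false ∷ E) (c ∷ termNFrom c n (elems n E) is) ∎
    where S = map suc (elems n E)
  new-block : ∀ E → inner (true ∷ E) ≡ ∑ᵗ (suc c) k (λ x r → blocks-from x r E)
  new-block E = begin
    with-elems (true ∷ E) (elems (suc n) (true ∷ E))
      ≡⟨ cong (with-elems (true ∷ E)) (elems-∷ n true E) ⟩
    ∑[ is ∈ choose (suc (length S)) (range (suc c) k) ] F (true ∷ E) (termNFrom c (suc n) (0 ∷ S) is)
      ≡⟨ cong (λ m → ∑[ is ∈ choose (suc m) (range (suc c) k) ] F (true ∷ E) (termNFrom c (suc n) (0 ∷ S) is))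
              (length-map suc (elems n E)) ⟩
    ∑[ is ∈ choose (suc (length (elems n E))) (range (suc c) k) ] F (true ∷ E) (termNFrom c (suc n) (0 ∷ S) is)
      ≡⟨ ∑-choose-suc (F (true ∷ E) ∘ termNFrom c (suc n) (0 ∷ S)) (length (elems n E)) (suc c) k ⟩
    ∑ᵗ (suc c) k (λ x r → ∑[ is ∈ choose (length (elems n E)) (range (suc x) r) ]
                             F (true ∷ E) (termNFrom x (suc n) S is))
      ≡⟨ ∑ᵗ-cong (suc c) k (λ x r _ → ∑-cong (choose (length (elems n E)) (range (suc x) r))
                                          (λ is → cong (F (true ∷ E)) (termNFrom-shift x n (elems n E) is))) ⟩
    ∑ᵗ (suc c) k (λ x r → blocks-from x r E) ∎
    where S = map suc (elems n E)

range-split : ∀ c k → range 0 (suc (c + k)) ≡ range 0 c ++ c ∷ range (suc c) k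
range-split c k = trans (cong (range 0) (sym (+-suc c k))) (range-++ 0 c (suc k))

monotoneSum-suc : ∀ n c k F → monotoneSum (suc n) c (c + k) F
  ≡ monotoneSum n c (c + k) (after false c F)
    + ∑[ x ∈ range (suc c) k ] monotoneSum n x (c + k) (after true x F)
monotoneSum-suc n c k F = begin
  monotoneSum (suc n) c (c + k) F
    ≡⟨ ∑-prepend (λ t → F (rises c t) t when nondecreasingFrom c t) L (tuples n L) ⟩
  ∑ H L
    ≡⟨ cong (∑ H) (range-split c k) ⟩
  ∑ H (range 0 c ++ c ∷ range (suc c) k)
    ≡⟨ ∑-++ H (range 0 c) (c ∷ range (suc c) k) ⟩
  ∑ H (range 0 c) + (H c + ∑ H (range (suc c) k))
    ≡⟨ cong₂ _+_ below (cong₂ _+_ at-c above) ⟩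
  monotoneSum n c (c + k) (after false c F)
    + ∑[ x ∈ range (suc c) k ] monotoneSum n x (c + k) (after true x F) ∎
  where
  L = range 0 (suc (c + k))
  H : ℕ → ℕ
  H x = ∑[ t ∈ tuples n L ] (F ((c <ᵇ x) ∷ rises x t) (x ∷ t) when (c ≤ᵇ x) ∧ nondecreasingFrom x t)
  below : ∑ H (range 0 c) ≡ 0
  below = trans (∑-range-cong 0 c (λ x _ x<c → trans
            (∑-cong (tuples n L) (λ t → cong (λ q → F ((c <ᵇ x) ∷ rises x t) (x ∷ t) when q ∧ nondecreasingFrom x t)
                                            (≤ᵇ-false x<c)))
            (∑-zero (tuples n L))))
          (∑-zero (range 0 c))
  at-c : H c ≡ monotoneSum n c (c + k) (after false c F)
  at-c = ∑-cong (tuples n L) (λ t → cong₂ (λ r q → F (r ∷ rises c t) (c ∷ t) when q ∧ nondecreasingFrom c t)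
                                          (<ᵇ-false (≤-refl {c})) (≤ᵇ-true (≤-refl {c})))
  above : ∑ H (range (suc c) k) ≡ ∑[ x ∈ range (suc c) k ] monotoneSum n x (c + k) (after true x F)
  above = ∑-range-cong (suc c) k (λ x c<x _ →
    ∑-cong (tuples n L) (λ t → cong₂ (λ r q → F (r ∷ rises x t) (x ∷ t) when q ∧ nondecreasingFrom x t)
                                     (<ᵇ-true c<x) (≤ᵇ-true (<⇒≤ c<x))))

blockSum≡monotoneSum : ∀ n c k F → blockSum n c k F ≡ monotoneSum n c (c + k) F
blockSum≡monotoneSum zero c k F = cong (_+ 0) (+-identityʳ (F [] []))
blockSum≡monotoneSum (suc n) c k F = begin
  blockSum (suc n) c k F
    ≡⟨ blockSum-suc n c k F ⟩
  blockSum n c k (after false c F) + ∑ᵗ (suc c) k (λ x r → blockSum n x r (after true x F))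
    ≡⟨ cong₂ _+_ (blockSum≡monotoneSum n c k (after false c F)) (∑ᵗ-cong (suc c) k later-blocks) ⟩
  monotoneSum n c (c + k) (after false c F) + ∑ᵗ (suc c) k (λ x _ → monotoneSum n x (c + k) (after true x F))
    ≡⟨ cong (_+_ _) (∑ᵗ-const (suc c) k (λ x → monotoneSum n x (c + k) (after true x F))) ⟩
  monotoneSum n c (c + k) (after false c F) + ∑[ x ∈ range (suc c) k ] monotoneSum n x (c + k) (after true x F)
    ≡⟨ monotoneSum-suc n c k F ⟨
  monotoneSum (suc n) c (c + k) F ∎
  where
  later-blocks : ∀ x r → x + suc r ≡ suc c + k →
    blockSum n x r (after true x F) ≡ monotoneSum n x (c + k) (after true x F)
  later-blocks x r x+1+r≡ = trans (blockSum≡monotoneSum n x r (after true x F))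
    (cong (λ K → monotoneSum n x K (after true x F)) (suc-injective (trans (sym (+-suc x r)) x+1+r≡)))

-- Left peaks of π

nth-toList : ∀ {n} (v : Vec ℕ n) k (k<n : k < n) → nth 0 (Vec.toList v) (suc k) ≡ lookup v (fromℕ< k<n)
nth-toList (x Vec.∷ v) zero _ = refl
nth-toList (x Vec.∷ v) (suc k) (s≤s k<n) = nth-toList v k k<n

pv-suc : ∀ {n} (π : Permutation′ n) k (k<n : k < n) → pv π (suc k) ≡ suc (toℕ (π ⟨$⟩ʳ fromℕ< k<n))
pv-suc {n} π k k<n = begin
  nth 0 (Vec.toList (Vec.map f (allFin n))) (suc k)  ≡⟨ nth-toList (Vec.map f (allFin n)) k k<n ⟩
  lookup (Vec.map f (allFin n)) (fromℕ< k<n)         ≡⟨ lookup-map (fromℕ< k<n) f (allFin n) ⟩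
  f (lookup (allFin n) (fromℕ< k<n))                 ≡⟨ cong f (lookup-allFin (fromℕ< k<n)) ⟩
  f (fromℕ< k<n)                                     ∎
  where
  f : Fin n → ℕ
  f i = suc (toℕ (π ⟨$⟩ʳ i))

pv-injective : ∀ {n} (π : Permutation′ n) {j k} (j<n : j < n) (k<n : k < n) →
  pv π (suc j) ≡ pv π (suc k) → j ≡ k
pv-injective π {j} {k} j<n k<n e = begin
  j                   ≡⟨ toℕ-fromℕ< j<n ⟨
  toℕ (fromℕ< j<n)    ≡⟨ cong toℕ (Injection.injective (↔⇒↣ π) (toℕ-injective (suc-injective πj≡πk))) ⟩
  toℕ (fromℕ< k<n)    ≡⟨ toℕ-fromℕ< k<n ⟩
  k                   ∎
  where
  πj≡πk = trans (sym (pv-suc π j j<n)) (trans e (pv-suc π k k<n))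

-- Since π(0) = 0 and π is injective, a left peak is a descent not preceded by a descent.
isLPe≡peak : ∀ n (π : Permutation′ n) i → i < n → isLPe n π i ≡ peak (isDes n π) i
isLPe≡peak n π zero _ = refl
isLPe≡peak n π (suc zero) 1<n rewrite pv-suc π 0 (<-trans z<s 1<n) = sym (∧-identityʳ _)
isLPe≡peak n π (suc (suc j)) 2+j<n = comparisons (<ᵇ-true 1+j<n) πj≢πj+1
  where
  1+j<n = <-trans (n<1+n (suc j)) 2+j<n
  πj≢πj+1 : pv π (suc j) ≢ pv π (suc (suc j))
  πj≢πj+1 e = 1+n≢n (sym (pv-injective π (<-trans (n<1+n j) 1+j<n) 1+j<n e))
  comparisons : (suc j <ᵇ n) ≡ true → pv π (suc j) ≢ pv π (suc (suc j)) →
    isLPe n π (suc (suc j)) ≡ peak (isDes n π) (suc (suc j))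
  comparisons 1+j<ᵇn ne rewrite <ᵇ-true 2+j<n | 1+j<ᵇn | <ᵇ-flip ne =
    ∧-comm (not (pv π (suc (suc j)) <ᵇ pv π (suc j))) (pv π (suc (suc (suc j))) <ᵇ pv π (suc (suc j)))

admissible≡admissibleFrom : ∀ n (π : Permutation′ n) E →
  admissible n π E ≡ admissibleFrom (peak (λ i → isDes n π (i ∸ 1))) (false ∷ E) n
admissible≡admissibleFrom n π E = allᵇ-congᴬ (All.tabulate (λ i∈ → condition _ (∈-upTo⁻ i∈)))
  where
  condition : ∀ i → i < n →
    (if isLPe n π i then memb E i ∨ ((1 ≤ᵇ i) ∧ memb E (i ∸ 1)) else true)
    ≡ (if peak (isDes n π) i then memb (false ∷ E) (suc i) ∨ memb (false ∷ E) i else true)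
  condition zero _ = refl
  condition (suc i) i<n rewrite isLPe≡peak n π (suc i) i<n = refl

valid-signings : ∀ n (π : Permutation′ n) t → length t ≡ n →
  ∑[ a ∈ signings t ] 𝟙 (validD n π a)
  ≡ 2 ^ length (elems n (rises 0 t)) when admissible n π (rises 0 t) when nondecreasingFrom 0 t
valid-signings .(length t) π t refl = begin
  ∑[ a ∈ signings t ] 𝟙 (valid d a (length t ∸ 1))
    ≡⟨ extensions-origin d t refl ⟩
  extensions d↑ (+ 0) t
    ≡⟨ extensions-positive t d↑ 0 refl ⟩
  2 ^ countᵇ id (rises 0 t) when admissibleFrom (peak d↑) (false ∷ rises 0 t) (length t)
                            when nondecreasingFrom 0 t
    ≡⟨ cong₂ (λ k a → 2 ^ k when a when nondecreasingFrom 0 t)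
         (length-elems (length t) (rises 0 t) (length-rises 0 t))
         (admissible≡admissibleFrom (length t) π (rises 0 t)) ⟨
  2 ^ length (elems (length t) (rises 0 t)) when admissible (length t) π (rises 0 t)
                                            when nondecreasingFrom 0 t ∎
  where
  d = isDes (length t) π
  d↑ = λ i → d (i ∸ 1)

oneTo≡range : ∀ K → oneTo K ≡ range 1 K
oneTo≡range K = trans (cong (map suc) (upTo≡range K)) (map-suc-range 0 K)

coeffRHS≡blockSum : ∀ n (π : Permutation′ n) K e → coeffRHS n π K e
  ≡ blockSum n 0 K (λ E t → 2 ^ length (elems n E) when admissible n π E when matches K e t)
coeffRHS≡blockSum n π K e =
  trans (sumℕ-map≡∑ _ (tuples n bits)) (∑-cong (tuples n bits) (λ E → trans
    (cong (λ L → 2 ^ ∣E∣ E * countᵇ (match E) (choose (∣E∣ E) L) when admissible n π E)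
          (oneTo≡range K))
    (*-countᵇ-when (2 ^ ∣E∣ E) (admissible n π E) (match E) (choose (∣E∣ E) (range 1 K)))))
  where
  ∣E∣ : List Bool → ℕ
  ∣E∣ E = length (elems n E)
  match : List Bool → List ℕ → Bool
  match E is = matches K e (termN n (elems n E) is)

corollary6p5 : (n : ℕ) → 1 ≤ n → (π : Permutation′ n) →
    (K : ℕ) → (e : Vec ℕ (suc K)) →
    coeffD n π K e ≡ coeffRHS n π K e
corollary6p5 n _ π K e = begin
  coeffD n π K e
    ≡⟨ count-by-profile n K (validD n π) (matches K e) ⟩
  ∑[ t ∈ tuples n (range 0 (suc K)) ] (∑[ a ∈ signings t ] 𝟙 (validD n π a) when matches K e t)
    ≡⟨ ∑-congᴬ (All.map (λ {t} len → trans (cong (_when matches K e t) (valid-signings n π t len))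
                                           (when-comm _ (nondecreasingFrom 0 t) (matches K e t)))
                        (length-tuples n (range 0 (suc K)))) ⟩
  monotoneSum n 0 K F
    ≡⟨ blockSum≡monotoneSum n 0 K F ⟨
  blockSum n 0 K F
    ≡⟨ coeffRHS≡blockSum n π K e ⟨
  coeffRHS n π K e ∎
  where
  F : List Bool → List ℕ → ℕ
  F E t = 2 ^ length (elems n E) when admissible n π E when matches K e t
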